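{- Let $w$ be a 2D word of size $(m,n)$. Then $0\le|PALConj(w)|\le 4$ if $m$ and $n$ are both even, $0\le|PALConj(w)|\le 1$ if $m$ and $n$ are both odd, and $0\le|PALConj(w)|\le 2$ otherwise.
   Context: A 2D word of size $(m,n)$ over a finite alphabet is an $m\times n$ array $w$ with rows $u_1,\dots,u_m$ and columns $v_1,\dots,v_n$. Its reverse is $w^R=[w_{m-i+1,\,n-j+1}]_{i,j}$ and $w$ is a 2D palindrome if $w=w^R$. For $1\le k\le n$, the cyclic rotation of $k$ columns is the word $\circlearrowleft^{Col}_k w$ whose columns are, in order, $v_{n-k+1},\dots,v_n,v_1,\dots,v_{n-k}$; for $1\le k\le m$, the cyclic rotation of $k$ rows is the word $\circlearrowleft^{Row}_k w$ whose rows are, in order, $u_{m-k+1},\dots,u_m,u_1,\dots,u_{m-k}$. The conjugacy class of $w$ is $Conj(w)=\{\circlearrowleft^{Col}_i\circlearrowleft^{Row}_j w : 1\le i\le n,\ 1\le j\le m\}$, and $PALConj(w)$ is the set of elements of $Conj(w)$ that are 2D palindromes. -}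

module Defs where

open import Data.Nat using (ℕ; zero; suc; _+_; _∸_; _≤_; NonZero)
open import Data.Nat.DivMod using (_%_; m%n<n)
open import Data.Fin using (Fin; toℕ; fromℕ<; opposite)
open import Data.Product using (Σ; ∃; _×_; _,_)
open import Data.List using (List; length)
open import Data.List.Relation.Unary.All using (All)
open import Data.List.Relation.Unary.AllPairs using (AllPairs)
open import Relation.Binary.PropositionalEquality using (_≡_)
open import Relation.Nullary using (¬_)

-- A 2D word of size (m,n) over alphabet A: entry w i j = w_{i+1,j+1} (0-indexed Fin).
Word2D : Set → ℕ → ℕ → Set
Word2D A m n = Fin m → Fin n → A

_≈_ : ∀ {A m n} → Word2D A m n → Word2D A m n → Set
w ≈ w' = ∀ i j → w i j ≡ w' i j

reverse2D : ∀ {A m n} → Word2D A m n → Word2D A m n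
reverse2D w i j = w (opposite i) (opposite j)

IsPal2D : ∀ {A m n} → Word2D A m n → Set
IsPal2D w = w ≈ reverse2D w

-- index (j - k) mod n, for 0-indexed j and shift k
shiftIdx : ∀ {n} → ℕ → Fin n → Fin n
shiftIdx {suc n} k j = fromℕ< (m%n<n (toℕ j + (suc n ∸ (k % suc n))) (suc n))

-- Cyclic rotation of k columns: columns become v_{n-k+1},...,v_n,v_1,...,v_{n-k},
-- i.e. new column j (0-indexed) is old column (j - k) mod n.
rotCol : ∀ {A m n} → ℕ → Word2D A m n → Word2D A m n
rotCol k w i j = w i (shiftIdx k j)

rotRow : ∀ {A m n} → ℕ → Word2D A m n → Word2D A m n
rotRow k w i j = w (shiftIdx k i) j

-- Membership in Conj(w) = { rotCol_i (rotRow_j w) : 1 ≤ i ≤ n, 1 ≤ j ≤ m }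
InConj : ∀ {A m n} → Word2D A m n → Word2D A m n → Set
InConj {m = m} {n = n} w v =
  Σ (Fin n) λ i → Σ (Fin m) λ j → v ≈ rotCol (suc (toℕ i)) (rotRow (suc (toℕ j)) w)

InPALConj : ∀ {A m n} → Word2D A m n → Word2D A m n → Set
InPALConj w v = InConj w v × IsPal2D v

-- |PALConj(w)| ≤ b : every list of pairwise distinct elements of PALConj(w)
-- has length at most b.
PALConjCardLe : ∀ {A m n} → Word2D A m n → ℕ → Set
PALConjCardLe {A} {m} {n} w b =
  (vs : List (Word2D A m n)) →
  All (InPALConj w) vs →
  AllPairs (λ u v → ¬ (u ≈ v)) vs →
  length vs ≤ b

-- Extend w periodically to ℤ². Its conjugates are the m × n windows of the extension at offsets
-- P ∈ ℤ², and two offsets give the same conjugate iff they differ by an element of the lattice L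
-- of periods. The window at P is a palindrome iff the extension is invariant under a point
-- reflection whose centre is determined by P, and two point reflections compose to the
-- translation by twice the difference of their centres' offsets. Hence distinct palindromic
-- conjugates give distinct elements of order ≤ 2 in ℤ²/L. This group is an extension of
-- ℤ/p (row components of L) by ℤ/q (column periods in L), where p ∣ m and q ∣ n; a cyclic group
-- has at most two elements of order ≤ 2, and only one when its order is odd.

module Submission where

open import Defs
open import Data.Nat as ℕ using (ℕ; zero; suc; _≤_; _≤?_; z≤n; s≤s)
import Data.Nat.Properties as ℕP
open import Data.Nat.Divisibility using (_∣_; divides; m%n≡0⇒n∣m; ∣-trans)
open import Data.Nat.Induction using (<-rec)
open import Data.Integer using (ℤ; +_; -[1+_]; +[1+_]; 0ℤ; _⊖_; _+_; _-_; -_; _*_)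
import Data.Integer.Properties as ℤP
open import Data.Integer.DivMod using (_%ℕ_; _/ℕ_; a≡a%ℕn+[a/ℕn]*n; n%ℕd<d)
open import Data.Integer.Tactic.RingSolver using (solve-∀)
open import Data.Fin using (Fin; toℕ; fromℕ<; opposite)
import Data.Fin.Properties as FinP
open import Data.Product using (Σ; _×_; _,_; proj₁; proj₂)
open import Data.Sum using (_⊎_; inj₁; inj₂; [_,_])
open import Data.Empty using (⊥-elim)
open import Data.List using (List; []; _∷_; length; filter)
open import Data.List.Relation.Unary.All as All using (All; []; _∷_)
import Data.List.Relation.Unary.All.Properties as AllP
open import Data.List.Relation.Unary.AllPairs using (AllPairs; []; _∷_)
import Data.List.Relation.Unary.AllPairs.Properties as AllPairsP
open import Function using (id)
open import Relation.Nullary using (¬_; yes; no)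
open import Relation.Nullary.Decidable using (map′; decidable-stable)
open import Relation.Unary using (Decidable)
open import Relation.Unary.Properties using (∁?)
open import Relation.Binary.PropositionalEquality hiding ([_])

transpose-multiple : ∀ a b k d → a ≡ b + k * d → b ≡ a + (- k) * d
transpose-multiple _ b k d refl = cancel b k d
  where
  cancel : ∀ b k d → b ≡ (b + k * d) + (- k) * d
  cancel = solve-∀

+r≢+r′+[1+k]*d : ∀ {d r} r′ k → r ℕ.< d → + r ≢ + r′ + +[1+ k ] * + d
+r≢+r′+[1+k]*d {d} {r} r′ k r<d eq = ℕP.<⇒≱ r<d (begin
    d                     ≤⟨ ℕP.m≤m+n d (k ℕ.* d) ⟩
    suc k ℕ.* d           ≤⟨ ℕP.m≤n+m _ r′ ⟩
    r′ ℕ.+ suc k ℕ.* d    ≡⟨ ℤP.+-injective (trans (cong (_+_ (+ r′)) (ℤP.pos-* (suc k) d)) (sym eq)) ⟩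
    r                     ∎)
  where open ℕP.≤-Reasoning

remainder-unique : ∀ {d r r′} k → r ℕ.< d → r′ ℕ.< d → + r ≡ + r′ + k * + d → r ≡ r′
remainder-unique {d} {r} {r′} (+ zero) _ _ eq =
  ℤP.+-injective (trans eq (trans (cong (_+_ (+ r′)) (ℤP.*-zeroˡ (+ d))) (ℤP.+-identityʳ (+ r′))))
remainder-unique {r′ = r′} +[1+ k ] r<d _ eq = ⊥-elim (+r≢+r′+[1+k]*d r′ k r<d eq)
remainder-unique {d} {r} {r′} -[1+ k ] _ r′<d eq =
  ⊥-elim (+r≢+r′+[1+k]*d r k r′<d (transpose-multiple (+ r) (+ r′) -[1+ k ] (+ d) eq))

module _ {d : ℕ} .{{_ : ℕ.NonZero d}} where

  %ℕ-unique : ∀ {x r} q → r ℕ.< d → x ≡ + r + q * + d → x %ℕ d ≡ r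
  %ℕ-unique {x} {r} q r<d eq = remainder-unique (q - x /ℕ d) (n%ℕd<d x d) r<d (begin
      + (x %ℕ d)                                ≡⟨ rearrange (+ (x %ℕ d)) (x /ℕ d) (+ d) ⟩
      (+ (x %ℕ d) + x /ℕ d * + d) - x /ℕ d * + d
        ≡⟨ cong (_- x /ℕ d * + d) (trans (sym (a≡a%ℕn+[a/ℕn]*n x d)) eq) ⟩
      (+ r + q * + d) - x /ℕ d * + d            ≡⟨ regroup (+ r) q (x /ℕ d) (+ d) ⟩
      + r + (q - x /ℕ d) * + d                  ∎)
    where
    open ≡-Reasoning
    rearrange : ∀ a q d → a ≡ (a + q * d) - q * d
    rearrange = solve-∀
    regroup : ∀ a q q′ d → (a + q * d) - q′ * d ≡ a + (q - q′) * d
    regroup = solve-∀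

  %ℕ-+-multiple : ∀ x k → (x + k * + d) %ℕ d ≡ x %ℕ d
  %ℕ-+-multiple x k = %ℕ-unique (x /ℕ d + k) (n%ℕd<d x d)
    (trans (cong (_+ k * + d) (a≡a%ℕn+[a/ℕn]*n x d)) (regroup (+ (x %ℕ d)) (x /ℕ d) k (+ d)))
    where
    regroup : ∀ a q k d → (a + q * d) + k * d ≡ a + (q + k) * d
    regroup = solve-∀

  twice-%ℕ : ∀ {x r} q → r ℕ.< d → x ≡ + (r ℕ.+ r) + q * + d → x %ℕ d ≡ 0 →
             r ℕ.+ r ≡ 0 ⊎ r ℕ.+ r ≡ d
  twice-%ℕ {x} {r} q r<d eq x%d≡0 with r ℕ.+ r ℕ.<? d
  ... | yes 2r<d = inj₁ (trans (sym (%ℕ-unique q 2r<d eq)) x%d≡0)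
  ... | no 2r≮d  = inj₂ (ℕP.≤-antisym (ℕP.m∸n≡0⇒m≤n
                     (trans (sym (%ℕ-unique (q + + 1) 2r∸d<d eq′)) x%d≡0)) d≤2r)
    where
    d≤2r : d ℕ.≤ r ℕ.+ r
    d≤2r = ℕP.≮⇒≥ 2r≮d
    2r∸d<d : r ℕ.+ r ℕ.∸ d ℕ.< d
    2r∸d<d = ℕP.+-cancelʳ-< d _ d (subst (ℕ._< d ℕ.+ d) (sym (ℕP.m∸n+n≡m d≤2r)) (ℕP.+-mono-< r<d r<d))
    carry : ∀ s q d → (s + d) + q * d ≡ s + (q + + 1) * d
    carry = solve-∀
    eq′ : x ≡ + (r ℕ.+ r ℕ.∸ d) + (q + + 1) * + d
    eq′ = trans eq (trans (cong (λ s → + s + q * + d) (sym (ℕP.m∸n+n≡m d≤2r)))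
                     (carry (+ (r ℕ.+ r ℕ.∸ d)) q (+ d)))

  double-%ℕ≡0 : ∀ a → (a + a) %ℕ d ≡ 0 → a %ℕ d ℕ.+ a %ℕ d ≡ 0 ⊎ a %ℕ d ℕ.+ a %ℕ d ≡ d
  double-%ℕ≡0 a = twice-%ℕ (a /ℕ d + a /ℕ d) (n%ℕd<d a d)
    (trans (cong₂ _+_ (a≡a%ℕn+[a/ℕn]*n a d) (a≡a%ℕn+[a/ℕn]*n a d)) (double (+ (a %ℕ d)) (a /ℕ d) (+ d)))
    where
    double : ∀ r q d → (r + q * d) + (r + q * d) ≡ (r + r) + (q + q) * d
    double = solve-∀

record IsAdditiveSubgroup (S : ℤ → Set) : Set where
  field
    0∈       : S 0ℤ
    +-closed : ∀ {a b} → S a → S b → S (a + b)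
    neg-closed : ∀ {a} → S a → S (- a)

  -closed : ∀ {a b} → S a → S b → S (a - b)
  -closed sa sb = +-closed sa (neg-closed sb)

  +*-closed : ∀ n {a} → S a → S (+ n * a)
  +*-closed zero    {a} _  = subst S (sym (ℤP.*-zeroˡ a)) 0∈
  +*-closed (suc n) {a} sa = subst S (sym (ℤP.suc-* (+ n) a)) (+-closed sa (+*-closed n sa))

  *-closed : ∀ k {a} → S a → S (k * a)
  *-closed (+ n)    sa = +*-closed n sa
  *-closed -[1+ n ] {a} sa = subst S (ℤP.neg-distribˡ-* (+ suc n) a) (neg-closed (+*-closed (suc n) sa))

record LeastPositive (S : ℤ → Set) : Set where
  constructor leastPositive
  field
    pred    : ℕ
    member  : S (+ suc pred)
    minimal : ∀ {r} → S (+ r) → r ℕ.< suc pred → r ≡ 0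

¬¬-leastPositive : ∀ {S} k → S (+ suc k) → ¬ ¬ LeastPositive S
¬¬-leastPositive {S} k sk none = <-rec (λ k → ¬ S (+ suc k)) nothing-smaller k sk
  where
  nothing-smaller : ∀ k → (∀ {j} → j ℕ.< k → ¬ S (+ suc j)) → ¬ S (+ suc k)
  nothing-smaller k ih sk = none (leastPositive k sk minimal)
    where
    minimal : ∀ {r} → S (+ r) → r ℕ.< suc k → r ≡ 0
    minimal {zero}  _  _         = refl
    minimal {suc j} sj (s≤s j<k) = ⊥-elim (ih j<k sj)

-- With its least positive element p, S = pℤ: membership is decided by the remainder mod p.
module LeastPositiveSubgroup {S : ℤ → Set} (subgroup : IsAdditiveSubgroup S) (least : LeastPositive S) where
  open IsAdditiveSubgroup subgroup
  open LeastPositive least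

  p : ℕ
  p = suc pred

  ∈⇒%ℕ≡0 : ∀ {a} → S a → a %ℕ p ≡ 0
  ∈⇒%ℕ≡0 {a} sa = minimal (subst S remainder (-closed sa (*-closed (a /ℕ p) member))) (n%ℕd<d a p)
    where
    cancel : ∀ r q d → (r + q * d) - q * d ≡ r
    cancel = solve-∀
    remainder : a - a /ℕ p * + p ≡ + (a %ℕ p)
    remainder = trans (cong (_- a /ℕ p * + p) (a≡a%ℕn+[a/ℕn]*n a p)) (cancel (+ (a %ℕ p)) (a /ℕ p) (+ p))

  %ℕ≡⇒∈-diff : ∀ {a b} → a %ℕ p ≡ b %ℕ p → S (b - a)
  %ℕ≡⇒∈-diff {a} {b} eq = subst S (sym difference) (*-closed (b /ℕ p - a /ℕ p) member)
    where
    regroup : ∀ r q q′ d → (r + q′ * d) - (r + q * d) ≡ (q′ - q) * d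
    regroup = solve-∀
    difference : b - a ≡ (b /ℕ p - a /ℕ p) * + p
    difference = begin
      b - a                                         ≡⟨ cong₂ _-_ (a≡a%ℕn+[a/ℕn]*n b p) (a≡a%ℕn+[a/ℕn]*n a p) ⟩
      (+ (b %ℕ p) + b /ℕ p * + p) - (+ (a %ℕ p) + a /ℕ p * + p)
        ≡⟨ cong (λ r → (+ r + b /ℕ p * + p) - (+ (a %ℕ p) + a /ℕ p * + p)) (sym eq) ⟩
      (+ (a %ℕ p) + b /ℕ p * + p) - (+ (a %ℕ p) + a /ℕ p * + p)
        ≡⟨ regroup (+ (a %ℕ p)) (a /ℕ p) (b /ℕ p) (+ p) ⟩
      (b /ℕ p - a /ℕ p) * + p                       ∎
      where open ≡-Reasoning

  %ℕ≡0⇒∈ : ∀ {a} → a %ℕ p ≡ 0 → S a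
  %ℕ≡0⇒∈ {a} eq = subst S (ℤP.+-identityʳ a) (%ℕ≡⇒∈-diff {0ℤ} {a} (sym eq))

  ∈? : Decidable S
  ∈? a = map′ %ℕ≡0⇒∈ ∈⇒%ℕ≡0 (a %ℕ p ℕ.≟ 0)

  double-∉ : ∀ a → S (a + a) → ¬ S a → a %ℕ p ℕ.+ a %ℕ p ≡ p
  double-∉ a saa a∉ = [ (λ 2r≡0 → ⊥-elim (a∉ (%ℕ≡0⇒∈ (ℕP.m+n≡0⇒m≡0 _ 2r≡0)))) , id ]
    (double-%ℕ≡0 a (∈⇒%ℕ≡0 saa))

  halves-∉⇒∈-diff : ∀ a b → S (a + a) → S (b + b) → ¬ S a → ¬ S b → S (b - a)
  halves-∉⇒∈-diff a b saa sbb a∉ b∉ = %ℕ≡⇒∈-diff {a} {b} (begin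
    a %ℕ p                      ≡⟨ ℕP.n≡⌊n+n/2⌋ _ ⟩
    ℕ.⌊ a %ℕ p ℕ.+ a %ℕ p /2⌋   ≡⟨ cong ℕ.⌊_/2⌋ (trans (double-∉ a saa a∉) (sym (double-∉ b sbb b∉))) ⟩
    ℕ.⌊ b %ℕ p ℕ.+ b %ℕ p /2⌋   ≡⟨ ℕP.n≡⌊n+n/2⌋ _ ⟨
    b %ℕ p                      ∎)
    where open ≡-Reasoning

  two-torsion : ∀ a b → S (a + a) → S (b + b) → S a ⊎ S b ⊎ S (b - a)
  two-torsion a b saa sbb with ∈? a | ∈? b
  ... | yes sa | _      = inj₁ sa
  ... | no _   | yes sb = inj₂ (inj₁ sb)
  ... | no a∉  | no b∉  = inj₂ (inj₂ (halves-∉⇒∈-diff a b saa sbb a∉ b∉))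

  halve-odd : ∀ {N} a → S (+ N) → ¬ 2 ∣ N → S (a + a) → S a
  halve-odd {N} a sN N-odd saa with ∈? a
  ... | yes sa = sa
  ... | no a∉  = ⊥-elim (N-odd (∣-trans 2∣p (m%n≡0⇒n∣m N p (∈⇒%ℕ≡0 sN))))
    where
    r : ℕ
    r = a %ℕ p
    2∣p : 2 ∣ p
    2∣p = divides r (trans (sym (double-∉ a saa a∉))
                           (trans (cong (r ℕ.+_) (sym (ℕP.+-identityʳ r))) (ℕP.*-comm 2 r)))

module _ {X : Set} where

  allPairs-from : ∀ {C : X → Set} {R : X → X → Set} → (∀ {x y} → C x → C y → R x y) →
                  ∀ {xs} → All C xs → AllPairs R xs
  allPairs-from f []         = []
  allPairs-from f (cx ∷ cxs) = All.map (f cx) cxs ∷ allPairs-from f cxs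

  length-filter+length-filter-∁ : ∀ {P : X → Set} (P? : Decidable P) xs →
    length (filter P? xs) ℕ.+ length (filter (∁? P?) xs) ≡ length xs
  length-filter+length-filter-∁ P? []       = refl
  length-filter+length-filter-∁ P? (x ∷ xs) with P? x
  ... | yes _ = cong suc (length-filter+length-filter-∁ P? xs)
  ... | no _  = trans (ℕP.+-suc _ _) (cong suc (length-filter+length-filter-∁ P? xs))

module _ {V Y : Set} {P : V → Set} (f : ∀ {v} → P v → Y) where

  length-reduce : ∀ {vs} (pvs : All P vs) → length (All.reduce f pvs) ≡ length vs
  length-reduce []         = refl
  length-reduce (_ ∷ pvs) = cong suc (length-reduce pvs)

  All-reduce : ∀ {Q : V → Set} {S : Y → Set} → (∀ {v} (pv : P v) → Q v → S (f pv)) →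
               ∀ {vs} (pvs : All P vs) → All Q vs → All S (All.reduce f pvs)
  All-reduce g []         []         = []
  All-reduce g (pv ∷ pvs) (qv ∷ qvs) = g pv qv ∷ All-reduce g pvs qvs

  AllPairs-reduce : ∀ {R : V → V → Set} {S : Y → Y → Set} →
                    (∀ {u v} (pu : P u) (pv : P v) → R u v → S (f pu) (f pv)) →
                    ∀ {vs} (pvs : All P vs) → AllPairs R vs → AllPairs S (All.reduce f pvs)
  AllPairs-reduce g []         []           = []
  AllPairs-reduce g (pv ∷ pvs) (rvs ∷ rvss) = All-reduce (g pv) pvs rvs ∷ AllPairs-reduce g pvs rvss

decompose : ∀ {d} .{{_ : ℕ.NonZero d}} (o x : ℤ) → Σ (Fin d) λ i → Σ ℤ λ k → x ≡ (+ toℕ i + o) + k * + d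
decompose {d} o x = fromℕ< (n%ℕd<d (x - o) d) , (x - o) /ℕ d , (begin
  x                                                 ≡⟨ shift x o ⟩
  (x - o) + o                                       ≡⟨ cong (_+ o) (a≡a%ℕn+[a/ℕn]*n (x - o) d) ⟩
  (+ ((x - o) %ℕ d) + (x - o) /ℕ d * + d) + o       ≡⟨ swap (+ ((x - o) %ℕ d)) ((x - o) /ℕ d * + d) o ⟩
  (+ ((x - o) %ℕ d) + o) + (x - o) /ℕ d * + d
    ≡⟨ cong (λ r → (+ r + o) + (x - o) /ℕ d * + d) (FinP.toℕ-fromℕ< _) ⟨
  (+ toℕ (fromℕ< (n%ℕd<d (x - o) d)) + o) + (x - o) /ℕ d * + d ∎)
  where
  open ≡-Reasoning
  shift : ∀ x o → x ≡ (x - o) + o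
  shift = solve-∀
  swap : ∀ r s o → (r + s) + o ≡ (r + o) + s
  swap = solve-∀

+toℕ-opposite : ∀ {k} (i : Fin (suc k)) → + toℕ (opposite i) ≡ + k - + toℕ i
+toℕ-opposite {k} i = begin
  + toℕ (opposite i)  ≡⟨ cong +_ (FinP.opposite-prop i) ⟩
  + (k ℕ.∸ toℕ i)     ≡⟨ ℤP.⊖-≥ (ℕP.≤-pred (FinP.toℕ<n i)) ⟨
  k ⊖ toℕ i           ≡⟨ ℤP.m-n≡m⊖n k (toℕ i) ⟨
  + k - + toℕ i       ∎
  where open ≡-Reasoning

module Conjugates {A : Set} (m′ n′ : ℕ) (w : Word2D A (suc m′) (suc n′)) where

  m n : ℕ
  m = suc m′
  n = suc n′

  extend : ℤ → ℤ → A
  extend x y = w (fromℕ< (n%ℕd<d x m)) (fromℕ< (n%ℕd<d y n))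

  extend-periodic : ∀ x y k l → extend (x + k * + m) (y + l * + n) ≡ extend x y
  extend-periodic x y k l = cong₂ w (FinP.fromℕ<-cong _ _ (%ℕ-+-multiple x k) _ _)
                                    (FinP.fromℕ<-cong _ _ (%ℕ-+-multiple y l) _ _)

  record IsPeriod (a b : ℤ) : Set where
    constructor period
    field invariant : ∀ x y → extend (x + a) (y + b) ≡ extend x y

  0-period : IsPeriod 0ℤ 0ℤ
  0-period = period λ x y → cong₂ extend (ℤP.+-identityʳ x) (ℤP.+-identityʳ y)

  +-period : ∀ {a b c d} → IsPeriod a b → IsPeriod c d → IsPeriod (a + c) (b + d)
  +-period {a} {b} {c} {d} (period ab) (period cd) = period λ x y → begin
    extend (x + (a + c)) (y + (b + d)) ≡⟨ cong₂ extend (ℤP.+-assoc x a c) (ℤP.+-assoc y b d) ⟨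
    extend ((x + a) + c) ((y + b) + d) ≡⟨ cd (x + a) (y + b) ⟩
    extend (x + a) (y + b)             ≡⟨ ab x y ⟩
    extend x y                         ∎
    where open ≡-Reasoning

  neg-period : ∀ {a b} → IsPeriod a b → IsPeriod (- a) (- b)
  neg-period {a} {b} (period ab) = period λ x y → begin
    extend (x - a) (y - b)             ≡⟨ ab (x - a) (y - b) ⟨
    extend ((x - a) + a) ((y - b) + b) ≡⟨ cong₂ extend (cancel x a) (cancel y b) ⟩
    extend x y                         ∎
    where
    open ≡-Reasoning
    cancel : ∀ x a → (x - a) + a ≡ x
    cancel = solve-∀

  -period : ∀ {a b c d} → IsPeriod a b → IsPeriod c d → IsPeriod (a - c) (b - d)
  -period ab cd = +-period ab (neg-period cd)

  m-period : IsPeriod (+ m) 0ℤ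
  m-period = period λ x y → begin
    extend (x + + m) (y + 0ℤ)                  ≡⟨ cong (λ k → extend (x + k) (y + 0ℤ)) (ℤP.*-identityˡ (+ m)) ⟨
    extend (x + + 1 * + m) (y + 0ℤ * + n)      ≡⟨ extend-periodic x y (+ 1) 0ℤ ⟩
    extend x y                                 ∎
    where open ≡-Reasoning

  n-period : IsPeriod 0ℤ (+ n)
  n-period = period λ x y → begin
    extend (x + 0ℤ) (y + + n)                  ≡⟨ cong (λ k → extend (x + 0ℤ) (y + k)) (ℤP.*-identityˡ (+ n)) ⟨
    extend (x + 0ℤ * + m) (y + + 1 * + n)      ≡⟨ extend-periodic x y 0ℤ (+ 1) ⟩
    extend x y                                 ∎
    where open ≡-Reasoning

  RowShift : ℤ → Set
  RowShift a = Σ ℤ (IsPeriod a)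

  ColumnPeriod : ℤ → Set
  ColumnPeriod b = IsPeriod 0ℤ b

  rowShift-subgroup : IsAdditiveSubgroup RowShift
  rowShift-subgroup = record
    { 0∈         = 0ℤ , 0-period
    ; +-closed   = λ (b , ab) (d , cd) → b + d , +-period ab cd
    ; neg-closed = λ (b , ab) → - b , neg-period ab
    }

  columnPeriod-subgroup : IsAdditiveSubgroup ColumnPeriod
  columnPeriod-subgroup = record
    { 0∈         = 0-period
    ; +-closed   = +-period
    ; neg-closed = neg-period
    }

  Point : Set
  Point = ℤ × ℤ

  conjugateAt : Point → Word2D A m n
  conjugateAt (a , b) i j = extend (+ toℕ i + a) (+ toℕ j + b)

  Congruent : Point → Point → Set
  Congruent (a , b) (c , d) = IsPeriod (c - a) (d - b)

  congruent⇒≈ : ∀ {P Q} → Congruent P Q → conjugateAt Q ≈ conjugateAt P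
  congruent⇒≈ {a , b} {c , d} (period PQ) i j = begin
    extend (+ toℕ i + c) (+ toℕ j + d)                         ≡⟨ cong₂ extend (via (+ toℕ i) a c) (via (+ toℕ j) b d) ⟩
    extend ((+ toℕ i + a) + (c - a)) ((+ toℕ j + b) + (d - b)) ≡⟨ PQ (+ toℕ i + a) (+ toℕ j + b) ⟩
    extend (+ toℕ i + a) (+ toℕ j + b)                         ∎
    where
    open ≡-Reasoning
    via : ∀ i a c → i + c ≡ (i + a) + (c - a)
    via = solve-∀

  IsSymmetricAbout : ℤ → ℤ → Set
  IsSymmetricAbout c d = ∀ x y → extend x y ≡ extend (c - x) (d - y)

  symmetries⇒period : ∀ {c d c′ d′} → IsSymmetricAbout c d → IsSymmetricAbout c′ d′ →
                      IsPeriod (c′ - c) (d′ - d)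
  symmetries⇒period {c} {d} {c′} {d′} cd c′d′ = period λ x y → begin
    extend (x + (c′ - c)) (y + (d′ - d))                   ≡⟨ c′d′ _ _ ⟩
    extend (c′ - (x + (c′ - c))) (d′ - (y + (d′ - d)))     ≡⟨ cong₂ extend (reflect c c′ x) (reflect d d′ y) ⟩
    extend (c - x) (d - y)                                 ≡⟨ cd x y ⟨
    extend x y                                             ∎
    where
    open ≡-Reasoning
    reflect : ∀ c c′ x → c′ - (x + (c′ - c)) ≡ c - x
    reflect = solve-∀

  -- conjugateAt (a , b) is a palindrome iff extend is invariant under the point reflection
  -- (x , y) ↦ (m′ + 2a − x , n′ + 2b − y).
  record Palindromic (P : Point) : Set where
    constructor palindromic
    field symmetric : IsSymmetricAbout (+ m′ + (proj₁ P + proj₁ P)) (+ n′ + (proj₂ P + proj₂ P))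

  palindromic⇒double-congruent : ∀ {a b c d} → Palindromic (a , b) → Palindromic (c , d) →
                                 IsPeriod ((c - a) + (c - a)) ((d - b) + (d - b))
  palindromic⇒double-congruent {a} {b} {c} {d} (palindromic P-sym) (palindromic Q-sym) =
    subst₂ IsPeriod (centres (+ m′) c a) (centres (+ n′) d b)
      (symmetries⇒period {+ m′ + (a + a)} {+ n′ + (b + b)} {+ m′ + (c + c)} {+ n′ + (d + d)} P-sym Q-sym)
    where
    centres : ∀ k c a → (k + (c + c)) - (k + (a + a)) ≡ (c - a) + (c - a)
    centres = solve-∀

  palindrome⇒symmetric : ∀ a b → IsPal2D (conjugateAt (a , b)) → IsSymmetricAbout (+ m′ + (a + a)) (+ n′ + (b + b))
  palindrome⇒symmetric a b pal x y with decompose {m} a x | decompose {n} b y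
  ... | i , k , refl | j , l , refl = begin
    extend ((+ toℕ i + a) + k * + m) ((+ toℕ j + b) + l * + n)
      ≡⟨ extend-periodic (+ toℕ i + a) (+ toℕ j + b) k l ⟩
    conjugateAt (a , b) i j
      ≡⟨ pal i j ⟩
    conjugateAt (a , b) (opposite i) (opposite j)
      ≡⟨ cong₂ extend (cong (_+ a) (+toℕ-opposite i)) (cong (_+ b) (+toℕ-opposite j)) ⟩
    extend ((+ m′ - + toℕ i) + a) ((+ n′ - + toℕ j) + b)
      ≡⟨ extend-periodic ((+ m′ - + toℕ i) + a) ((+ n′ - + toℕ j) + b) (- k) (- l) ⟨
    extend (((+ m′ - + toℕ i) + a) + (- k) * + m) (((+ n′ - + toℕ j) + b) + (- l) * + n)
      ≡⟨ cong₂ extend (reflect (+ m′) (+ toℕ i) a k (+ m)) (reflect (+ n′) (+ toℕ j) b l (+ n)) ⟩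
    extend ((+ m′ + (a + a)) - ((+ toℕ i + a) + k * + m)) ((+ n′ + (b + b)) - ((+ toℕ j + b) + l * + n))
      ∎
    where
    open ≡-Reasoning
    reflect : ∀ k i a q d → ((k - i) + a) + (- q) * d ≡ (k + (a + a)) - ((i + a) + q * d)
    reflect = solve-∀

  palindrome⇒palindromic : ∀ P → IsPal2D (conjugateAt P) → Palindromic P
  palindrome⇒palindromic (a , b) pal = palindromic (palindrome⇒symmetric a b pal)

  period-from-column-offset : ∀ {a b t} → IsPeriod a t → ColumnPeriod (b - t) → IsPeriod a b
  period-from-column-offset {a} {b} {t} at b-t = subst₂ IsPeriod (ℤP.+-identityʳ a) (restore t b) (+-period at b-t)
    where
    restore : ∀ t b → t + (b - t) ≡ b
    restore = solve-∀

  double-column-offset : ∀ {a t} b → IsPeriod (a + a) (b + b) → IsPeriod a t → ColumnPeriod ((b - t) + (b - t))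
  double-column-offset {a} {t} b 2a2b at = subst₂ IsPeriod (cancel a) (regroup b t) (-period (-period 2a2b at) at)
    where
    cancel : ∀ a → ((a + a) - a) - a ≡ 0ℤ
    cancel = solve-∀
    regroup : ∀ b t → ((b + b) - t) - t ≡ (b - t) + (b - t)
    regroup = solve-∀

  SameRowClass : Point → Point → Set
  SameRowClass (a , _) (c , _) = RowShift (c - a)

  Incongruent : Point → Point → Set
  Incongruent P Q = ¬ Congruent P Q

  RowClassBound : ℕ → Set
  RowClassBound k = ∀ ps → All Palindromic ps → AllPairs Incongruent ps → AllPairs SameRowClass ps → length ps ≤ k

  module Counting (rows : LeastPositive RowShift) (columns : LeastPositive ColumnPeriod) where
    private
      module R = LeastPositiveSubgroup rowShift-subgroup rows
      module C = LeastPositiveSubgroup columnPeriod-subgroup columns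

    -- The column offsets of Q and S over P have order ≤ 2 modulo the column periods.
    sameRowClass-triple : ∀ {P Q S} → Palindromic P → Palindromic Q → Palindromic S →
      SameRowClass P Q → SameRowClass P S → Congruent P Q ⊎ Congruent P S ⊎ Congruent Q S
    sameRowClass-triple {a , b} {c , d} {e , f} P-pal Q-pal S-pal (t , PQ) (s , PS)
      with C.two-torsion ((d - b) - t) ((f - b) - s)
             (double-column-offset (d - b) (palindromic⇒double-congruent P-pal Q-pal) PQ)
             (double-column-offset (f - b) (palindromic⇒double-congruent P-pal S-pal) PS)
    ... | inj₁ u           = inj₁ (period-from-column-offset PQ u)
    ... | inj₂ (inj₁ v)    = inj₂ (inj₁ (period-from-column-offset PS v))
    ... | inj₂ (inj₂ v-u) =
      inj₂ (inj₂ (period-from-column-offset (subst₂ IsPeriod (rebase e c a) refl (-period PS PQ))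
                                            (subst ColumnPeriod (shift f d b s t) v-u)))
      where
      rebase : ∀ e c a → (e - a) - (c - a) ≡ e - c
      rebase = solve-∀
      shift : ∀ f d b s t → ((f - b) - s) - ((d - b) - t) ≡ (f - d) - (s - t)
      shift = solve-∀

    rowClass-≤2 : RowClassBound 2
    rowClass-≤2 []                _ _ _ = z≤n
    rowClass-≤2 (_ ∷ [])          _ _ _ = s≤s z≤n
    rowClass-≤2 (_ ∷ _ ∷ [])      _ _ _ = s≤s (s≤s z≤n)
    rowClass-≤2 (P ∷ Q ∷ S ∷ _) (P-pal ∷ Q-pal ∷ S-pal ∷ _)
      ((P≉Q ∷ P≉S ∷ _) ∷ (Q≉S ∷ _) ∷ _) ((PQ ∷ PS ∷ _) ∷ _)
      with sameRowClass-triple {P} {Q} {S} P-pal Q-pal S-pal PQ PS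
    ... | inj₁ P≈Q         = ⊥-elim (P≉Q P≈Q)
    ... | inj₂ (inj₁ P≈S)  = ⊥-elim (P≉S P≈S)
    ... | inj₂ (inj₂ Q≈S)  = ⊥-elim (Q≉S Q≈S)

    rowClass-≤1 : ¬ 2 ∣ n → RowClassBound 1
    rowClass-≤1 n-odd []          _ _ _ = z≤n
    rowClass-≤1 n-odd (_ ∷ [])    _ _ _ = s≤s z≤n
    rowClass-≤1 n-odd ((a , b) ∷ (c , d) ∷ _) (P-pal ∷ Q-pal ∷ _) ((P≉Q ∷ _) ∷ _) (((t , PQ) ∷ _) ∷ _) =
      ⊥-elim (P≉Q (period-from-column-offset PQ
        (C.halve-odd ((d - b) - t) n-period n-odd
          (double-column-offset (d - b) (palindromic⇒double-congruent P-pal Q-pal) PQ))))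

    length-≤-oneRowClass : ¬ 2 ∣ m → ∀ {k} → RowClassBound k →
                  ∀ ps → All Palindromic ps → AllPairs Incongruent ps → length ps ≤ k
    length-≤-oneRowClass m-odd bound ps pals incs = bound ps pals incs (allPairs-from sameRowClass pals)
      where
      sameRowClass : ∀ {P Q} → Palindromic P → Palindromic Q → SameRowClass P Q
      sameRowClass {a , b} {c , d} P-pal Q-pal =
        R.halve-odd (c - a) (0ℤ , m-period) m-odd (_ , palindromic⇒double-congruent P-pal Q-pal)

    -- ℤ modulo the row shifts has at most one element of order 2, so the row offsets from the
    -- first point fall into two classes.
    length-≤-twoRowClasses : ∀ {k} → RowClassBound k →
                    ∀ ps → All Palindromic ps → AllPairs Incongruent ps → length ps ≤ k ℕ.+ k
    length-≤-twoRowClasses bound [] _ _ = z≤n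
    length-≤-twoRowClasses {k} bound ps@((a , b) ∷ _) pals@(base-pal ∷ _) incs = begin
      length ps                                 ≡⟨ length-filter+length-filter-∁ inBase? ps ⟨
      length inside ℕ.+ length outside          ≤⟨ ℕP.+-mono-≤ inside-≤ outside-≤ ⟩
      k ℕ.+ k                                   ∎
      where
      open ℕP.≤-Reasoning
      InBaseClass : Point → Set
      InBaseClass (c , _) = RowShift (c - a)
      inBase? : Decidable InBaseClass
      inBase? (c , _) = R.∈? (c - a)
      inside outside : List Point
      inside  = filter inBase? ps
      outside = filter (∁? inBase?) ps
      rebase : ∀ e c a → (e - a) - (c - a) ≡ e - c
      rebase = solve-∀
      same-inside : ∀ {P Q} → InBaseClass P → InBaseClass Q → SameRowClass P Q
      same-inside {c , _} {e , _} P-in Q-in =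
        subst RowShift (rebase e c a) (IsAdditiveSubgroup.-closed rowShift-subgroup Q-in P-in)
      same-outside : ∀ {P Q} → Palindromic P × ¬ InBaseClass P → Palindromic Q × ¬ InBaseClass Q → SameRowClass P Q
      same-outside {c , d} {e , f} (P-pal , P-out) (Q-pal , Q-out) =
        subst RowShift (rebase e c a) (R.halves-∉⇒∈-diff (c - a) (e - a)
          (_ , palindromic⇒double-congruent base-pal P-pal) (_ , palindromic⇒double-congruent base-pal Q-pal)
          P-out Q-out)
      inside-≤ : length inside ≤ k
      inside-≤ = bound inside (AllP.filter⁺ inBase? pals) (AllPairsP.filter⁺ inBase? incs)
                   (allPairs-from (λ {P} {Q} → same-inside {P} {Q}) (AllP.all-filter inBase? ps))
      outside-≤ : length outside ≤ k
      outside-≤ = bound outside (AllP.filter⁺ (∁? inBase?) pals) (AllPairsP.filter⁺ (∁? inBase?) incs)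
                    (allPairs-from same-outside
                      (All.zip (AllP.filter⁺ (∁? inBase?) pals , AllP.all-filter (∁? inBase?) ps)))

  -- Rotating by k rows reads row (i − k) mod m, i.e. row i + (m ∸ k % m) of extend; so the
  -- correspondence with conjugateAt holds by definition.
  conjugatePoint : ∀ {v} → InConj w v → Point
  conjugatePoint (i , j , _) = + (m ℕ.∸ suc (toℕ j) ℕ.% m) , + (n ℕ.∸ suc (toℕ i) ℕ.% n)

  conjugatePoint-≈ : ∀ {v} (c : InConj w v) → v ≈ conjugateAt (conjugatePoint c)
  conjugatePoint-≈ (_ , _ , v≈) = v≈

  palConjPoint : ∀ {v} → InPALConj w v → Point
  palConjPoint (c , _) = conjugatePoint c

  palConjPoint-palindromic : ∀ {v} (pv : InPALConj w v) → Palindromic (palConjPoint pv)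
  palConjPoint-palindromic (c , pal) = palindrome⇒palindromic (conjugatePoint c) λ i j →
    trans (sym (conjugatePoint-≈ c i j)) (trans (pal i j) (conjugatePoint-≈ c (opposite i) (opposite j)))

  palConjPoint-incongruent : ∀ {u v} (pu : InPALConj w u) (pv : InPALConj w v) →
                             ¬ u ≈ v → Incongruent (palConjPoint pu) (palConjPoint pv)
  palConjPoint-incongruent (cu , _) (cv , _) u≉v PQ = u≉v λ i j →
    trans (conjugatePoint-≈ cu i j)
      (trans (sym (congruent⇒≈ {conjugatePoint cu} {conjugatePoint cv} PQ i j)) (sym (conjugatePoint-≈ cv i j)))

  -- The generators of the row shifts and column periods exist only under a double negation,
  -- which is harmless because the bound is decidable.
  cardLe-from-points : ∀ K → (LeastPositive RowShift → LeastPositive ColumnPeriod →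
                       ∀ ps → All Palindromic ps → AllPairs Incongruent ps → length ps ≤ K) →
                       PALConjCardLe w K
  cardLe-from-points K bound vs pvs distinct = decidable-stable (length vs ≤? K) λ too-long →
    ¬¬-leastPositive {RowShift} m′ (0ℤ , m-period) λ rows →
    ¬¬-leastPositive {ColumnPeriod} n′ n-period λ columns →
    too-long (subst (_≤ K) (length-reduce palConjPoint pvs)
      (bound rows columns (All.reduce palConjPoint pvs)
        (All-reduce palConjPoint (λ pv _ → palConjPoint-palindromic pv) pvs pvs)
        (AllPairs-reduce palConjPoint palConjPoint-incongruent pvs distinct)))

cardLe-without-conjugates : ∀ {A m n} (w : Word2D A m n) → (∀ {v} → ¬ InConj w v) → ∀ K → PALConjCardLe w K
cardLe-without-conjugates w none K []      _               _ = z≤n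
cardLe-without-conjugates w none K (_ ∷ _) ((c , _) ∷ _) _ = ⊥-elim (none c)

theorem4p8 : {A : Set} (m n : ℕ) (w : Word2D A m n) →
    ((2 ∣ m × 2 ∣ n) → PALConjCardLe w 4) ×
    ((¬ 2 ∣ m × ¬ 2 ∣ n) → PALConjCardLe w 1) ×
    (((2 ∣ m × ¬ 2 ∣ n) ⊎ (¬ 2 ∣ m × 2 ∣ n)) → PALConjCardLe w 2)
theorem4p8 zero n w = let bound = cardLe-without-conjugates w λ { (_ , () , _) } in
  (λ _ → bound 4) , (λ _ → bound 1) , (λ _ → bound 2)
theorem4p8 (suc m′) zero w = let bound = cardLe-without-conjugates w λ { (() , _) } in
  (λ _ → bound 4) , (λ _ → bound 1) , (λ _ → bound 2)
theorem4p8 (suc m′) (suc n′) w =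
  (λ _ → cardLe-from-points 4 λ r c → length-≤-twoRowClasses r c (rowClass-≤2 r c)) ,
  (λ (m-odd , n-odd) → cardLe-from-points 1 λ r c → length-≤-oneRowClass r c m-odd (rowClass-≤1 r c n-odd)) ,
  λ { (inj₁ (_ , n-odd)) → cardLe-from-points 2 λ r c → length-≤-twoRowClasses r c (rowClass-≤1 r c n-odd)
    ; (inj₂ (m-odd , _)) → cardLe-from-points 2 λ r c → length-≤-oneRowClass r c m-odd (rowClass-≤2 r c) }
  where
  open Conjugates m′ n′ w
  open Counting
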